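{- $\text{2CC}$ is $(2k+1,k)$-universal for every integer $k\ge1$.
   Context: $\text{2CC}$ is the set of finite simple graphs, viewed as structures over the vocabulary $\sigma_g=\langle E^2\rangle$ with universe $\{0,\dots,m-1\}$ and $E$ symmetric and irreflexive, that admit a 2-coloring of the vertices such that no maximal clique is monochromatic. Consistency and universality (for the graph vocabulary, which has no constant symbols): given $m$ and a conjunction $\bigwedge_{j=1}^t L_j(u_j,v_j)$ where each $L_j$ is $E$ or $\neg E$ and $u_j,v_j\in\{0,\dots,m-1\}$, it is $m$-consistent if some simple graph on vertex set $\{0,\dots,m-1\}$ satisfies it, and $m$-consistent in a set $S$ of graphs if some graph in $S$ with $m$ vertices satisfies it. $S$ is $(n,t)$-universal if for every $m\ge n$ and every such conjunction of $t$ literals, $m$-consistency implies $m$-consistency in $S$. -}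

module Defs where

open import Data.Nat using (ℕ; suc; _+_; _*_; _≥_)
open import Data.Fin using (Fin)
open import Data.Bool using (Bool; true; false)
open import Data.Fin.Subset using (Subset; _∈_; _⊆_)
open import Data.Vec using (Vec)
open import Data.Vec.Relation.Unary.All using (All)
open import Data.Product using (Σ; _×_; ∃)
open import Relation.Binary.PropositionalEquality using (_≡_; _≢_)
open import Relation.Nullary using (¬_)

record Graph (m : ℕ) : Set where
  field
    adj    : Fin m → Fin m → Bool
    sym    : ∀ u v → adj u v ≡ adj v u
    irrefl : ∀ u → adj u u ≡ false

  E : Fin m → Fin m → Set
  E u v = adj u v ≡ true

open Graph public

IsClique : ∀ {m} → Graph m → Subset m → Set
IsClique G C = ∀ u v → u ∈ C → v ∈ C → u ≢ v → E G u v

IsMaximalClique : ∀ {m} → Graph m → Subset m → Set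
IsMaximalClique G C =
  IsClique G C × (∀ D → IsClique G D → C ⊆ D → D ⊆ C)

Monochromatic : ∀ {m} → (Fin m → Bool) → Subset m → Set
Monochromatic col C = Σ Bool λ c → ∀ v → v ∈ C → col v ≡ c

TwoCC : ∀ {m} → Graph m → Set
TwoCC G = Σ (Fin _ → Bool) λ col → ∀ C → IsMaximalClique G C → ¬ Monochromatic col C

record Literal (m : ℕ) : Set where
  constructor lit
  field
    positive : Bool
    u v      : Fin m

SatLit : ∀ {m} → Graph m → Literal m → Set
SatLit G (lit true  u v) = E G u v
SatLit G (lit false u v) = ¬ E G u v

Conj : ℕ → ℕ → Set
Conj m t = Vec (Literal m) t

Sat : ∀ {m t} → Graph m → Conj m t → Set
Sat G φ = All (SatLit G) φ

Consistent : ∀ {m t} → Conj m t → Set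
Consistent {m} φ = Σ (Graph m) λ G → Sat G φ

ConsistentIn : (∀ {m} → Graph m → Set) → ∀ {m t} → Conj m t → Set
ConsistentIn S {m} φ = Σ (Graph m) λ G → S G × Sat G φ

Universal : (∀ {m} → Graph m → Set) → ℕ → ℕ → Set
Universal S n t = ∀ m → m ≥ n → (φ : Conj m t) → Consistent φ → ConsistentIn S φ

-- Pick a vertex z that no literal mentions (a conjunction of k literals mentions at most
-- 2k < m vertices) and join z to every other vertex. The literals still hold, and every
-- maximal clique of the resulting cone contains the apex z together with some other vertex,
-- so colouring z apart from the rest leaves no maximal clique monochromatic.
module Submission where

open import Defs
open import Data.Nat using (ℕ; suc; _+_; _*_; _≤_; _<_; _≥_; s≤s; z≤n)
open import Data.Nat.Properties using (≤-trans; <⇒≱; +-comm; +-suc; *-monoʳ-≤; +-monoˡ-≤)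
open import Data.Fin using (Fin; zero; _≟_; punchIn)
open import Data.Fin.Properties using (¬∀⟶∃¬; injective⇒≤; punchInᵢ≢i)
open import Data.Fin.Subset using (_∪_; ⁅_⁆) renaming (_∈_ to _∈ₛ_)
open import Data.Fin.Subset.Properties using (x∈⁅x⁆; x∈⁅y⁆⇒x≡y; p⊆p∪q; x∈p∪q⁻; x∈p∪q⁺)
open import Data.Bool using (Bool; true; false)
open import Data.Vec using ([]; _∷_)
open import Data.Vec.Relation.Unary.All using ([]; _∷_)
open import Data.List using (List; []; _∷_; length; lookup)
open import Data.List.Relation.Unary.Any using (here; there; index; any?)
open import Data.List.Relation.Unary.Any.Properties using (lookup-index)
open import Data.List.Membership.Propositional using (_∈_; _∉_)
open import Data.Product using (∃; _,_; proj₁; proj₂)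
open import Data.Sum using (inj₁; inj₂)
open import Relation.Nullary using (¬_; does; yes; no; contradiction)
open import Relation.Nullary.Decidable using (dec-true; dec-false)
open import Relation.Binary.PropositionalEquality
  using (_≡_; _≢_; refl; trans; cong; subst) renaming (sym to ≡-sym)

private
  variable
    m t : ℕ

mentioned : Conj m t → List (Fin m)
mentioned []                = []
mentioned (lit _ u v ∷ φ) = u ∷ v ∷ mentioned φ

length-mentioned : (φ : Conj m t) → length (mentioned φ) ≡ 2 * t
length-mentioned [] = refl
length-mentioned {t = suc t} (_ ∷ φ) =
  cong suc (trans (cong suc (length-mentioned φ)) (≡-sym (+-suc t (t + 0))))

-- If every vertex occurred in xs, indexing into xs would inject Fin m into Fin (length xs).
length<⇒∃∉ : (xs : List (Fin m)) → length xs < m → ∃ λ z → z ∉ xs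
length<⇒∃∉ {m} xs xs<m = ¬∀⟶∃¬ m (_∈ xs) (λ z → any? (z ≟_) xs) λ all∈ →
  <⇒≱ xs<m (injective⇒≤ {f = λ z → index (all∈ z)} λ {x} {y} eq →
    trans (lookup-index (all∈ x)) (trans (cong (lookup xs) eq) (≡-sym (lookup-index (all∈ y)))))

∃≢ : 2 ≤ m → (z : Fin m) → ∃ λ w → w ≢ z
∃≢ {1}           (s≤s ()) _
∃≢ {suc (suc _)} _        z = punchIn z zero , punchInᵢ≢i z zero

SatLit-cong : (G H : Graph m) (b : Bool) (u v : Fin m) →
              adj G u v ≡ adj H u v → SatLit G (lit b u v) → SatLit H (lit b u v)
SatLit-cong G H true  u v eq Euv  = trans (≡-sym eq) Euv
SatLit-cong G H false u v eq ¬Euv = λ Euv → ¬Euv (trans eq Euv)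

Sat-agreeOff : (G H : Graph m) (z : Fin m) →
               (∀ u v → u ≢ z → v ≢ z → adj G u v ≡ adj H u v) →
               (φ : Conj m t) → z ∉ mentioned φ → Sat G φ → Sat H φ
Sat-agreeOff G H z agree []                z∉ []       = []
Sat-agreeOff G H z agree (lit b u v ∷ φ) z∉ (s ∷ ss) =
  SatLit-cong G H b u v (agree u v (λ u≡z → z∉ (here (≡-sym u≡z)))
                                   (λ v≡z → z∉ (there (here (≡-sym v≡z))))) s
  ∷ Sat-agreeOff G H z agree φ (λ z∈ → z∉ (there (there z∈))) ss

module _ (G : Graph m) where

  IsClique-∪⁅⁆ : ∀ C x → IsClique G C → (∀ u → u ∈ₛ C → u ≢ x → E G u x) →
                 IsClique G (C ∪ ⁅ x ⁆)
  IsClique-∪⁅⁆ C x cl Ex u v u∈ v∈ u≢v with x∈p∪q⁻ C ⁅ x ⁆ u∈ | x∈p∪q⁻ C ⁅ x ⁆ v∈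
  ... | inj₁ u∈C | inj₁ v∈C = cl u v u∈C v∈C u≢v
  ... | inj₁ u∈C | inj₂ v∈x rewrite x∈⁅y⁆⇒x≡y x v∈x = Ex u u∈C u≢v
  ... | inj₂ u∈x | inj₁ v∈C rewrite x∈⁅y⁆⇒x≡y x u∈x =
    trans (sym G x v) (Ex v v∈C (λ v≡x → u≢v (≡-sym v≡x)))
  ... | inj₂ u∈x | inj₂ v∈x =
    contradiction (trans (x∈⁅y⁆⇒x≡y x u∈x) (≡-sym (x∈⁅y⁆⇒x≡y x v∈x))) u≢v

  IsMaximalClique-∋ : ∀ C x → IsMaximalClique G C → (∀ u → u ∈ₛ C → u ≢ x → E G u x) →
                      x ∈ₛ C
  IsMaximalClique-∋ C x (cl , maximal) Ex =
    maximal (C ∪ ⁅ x ⁆) (IsClique-∪⁅⁆ C x cl Ex) (p⊆p∪q ⁅ x ⁆) (x∈p∪q⁺ (inj₂ (x∈⁅x⁆ x)))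

module Cone (G : Graph m) (z : Fin m) where

  coneAdj : Fin m → Fin m → Bool
  coneAdj u v with u ≟ z | v ≟ z
  ... | yes _ | yes _ = false
  ... | yes _ | no  _ = true
  ... | no  _ | yes _ = true
  ... | no  _ | no  _ = adj G u v

  cone : Graph m
  cone = record { adj = coneAdj ; sym = coneAdj-sym ; irrefl = coneAdj-irrefl }
    where
    coneAdj-sym : ∀ u v → coneAdj u v ≡ coneAdj v u
    coneAdj-sym u v with u ≟ z | v ≟ z
    ... | yes _ | yes _ = refl
    ... | yes _ | no  _ = refl
    ... | no  _ | yes _ = refl
    ... | no  _ | no  _ = sym G u v

    coneAdj-irrefl : ∀ u → coneAdj u u ≡ false
    coneAdj-irrefl u with u ≟ z
    ... | yes _ = refl
    ... | no  _ = irrefl G u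

  cone-agreeOff : ∀ u v → u ≢ z → v ≢ z → adj G u v ≡ adj cone u v
  cone-agreeOff u v u≢z v≢z with u ≟ z | v ≟ z
  ... | yes u≡z | _       = contradiction u≡z u≢z
  ... | no  _   | yes v≡z = contradiction v≡z v≢z
  ... | no  _   | no  _   = refl

  cone-apex : ∀ u → u ≢ z → E cone u z
  cone-apex u u≢z with u ≟ z | z ≟ z
  ... | yes u≡z | _       = contradiction u≡z u≢z
  ... | no  _   | yes _   = refl
  ... | no  _   | no  z≢z = contradiction refl z≢z

  isApex : Fin m → Bool
  isApex v = does (v ≟ z)

  cone-¬monochromatic : ∀ w → w ≢ z → ∀ C → IsMaximalClique cone C → ¬ Monochromatic isApex C
  cone-¬monochromatic w w≢z C maxC (c , mono) =
    contradiction (trans (≡-sym (dec-false (w ≟ z) w≢z)) (trans (mono w w∈C) c≡true)) λ ()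
    where
    c≡true : c ≡ true
    c≡true = trans (≡-sym (mono z (IsMaximalClique-∋ cone C z maxC λ u _ → cone-apex u)))
                   (dec-true (z ≟ z) refl)

    onlyApex : ∀ u → u ∈ₛ C → u ≡ z
    onlyApex u u∈C with u ≟ z | mono u u∈C
    ... | yes u≡z | _        = u≡z
    ... | no  _   | false≡c = contradiction (trans false≡c c≡true) λ ()

    Ew : ∀ u → u ∈ₛ C → u ≢ w → E cone u w
    Ew u u∈C _ = trans (sym cone u w)
                       (subst (E cone w) (≡-sym (onlyApex u u∈C)) (cone-apex w w≢z))

    w∈C : w ∈ₛ C
    w∈C = IsMaximalClique-∋ cone C w maxC Ew

  cone-TwoCC : ∀ w → w ≢ z → TwoCC cone
  cone-TwoCC w w≢z = isApex , cone-¬monochromatic w w≢z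

lemma2 : ∀ (k : ℕ) → k ≥ 1 → Universal TwoCC (2 * k + 1) k
lemma2 k k≥1 m m≥2k+1 φ (G , sat) =
  cone , cone-TwoCC w w≢z , Sat-agreeOff G cone z cone-agreeOff φ z∉ sat
  where
  mentioned<m : length (mentioned φ) < m
  mentioned<m = subst (_< m) (≡-sym (length-mentioned φ)) (subst (_≤ m) (+-comm (2 * k) 1) m≥2k+1)

  z : Fin m
  z = proj₁ (length<⇒∃∉ (mentioned φ) mentioned<m)

  z∉ : z ∉ mentioned φ
  z∉ = proj₂ (length<⇒∃∉ (mentioned φ) mentioned<m)

  m≥2 : 2 ≤ m
  m≥2 = ≤-trans (s≤s (s≤s z≤n)) (≤-trans (+-monoˡ-≤ 1 (*-monoʳ-≤ 2 k≥1)) m≥2k+1)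

  w : Fin m
  w = proj₁ (∃≢ m≥2 z)

  w≢z : w ≢ z
  w≢z = proj₂ (∃≢ m≥2 z)

  open Cone G z
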